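{- Writing $\vdash$ for $\vdash_{\mathrm{sq}Ł^*}$ and $\vdash p\leftrightarrow q$ for "$\vdash p\to q$ and $\vdash q\to p$", for all $p,q,r,t\in F(V)$: (1) if $\vdash p\leftrightarrow q$ then $\vdash\neg p\leftrightarrow\neg q$; (2) if $\vdash p\leftrightarrow q$ and $\vdash r\leftrightarrow t$ then $\vdash(p\to r)\leftrightarrow(q\to t)$; (3) if $\vdash p\leftrightarrow q$ and $\vdash q\leftrightarrow r$ then $\vdash p\leftrightarrow r$; (4) $\vdash\neg(p\to q)\leftrightarrow(\neg p\to\neg q)$; (5) $\vdash p\to p$; (6) if $\vdash p_1\leftrightarrow r_1$, then $\vdash p\leftrightarrow r$, where $p_1$ is a subformula of $p$ and $r$ is obtained by replacing $p_1$ in $p$ with $r_1$; (7) $\vdash(p\to p)\leftrightarrow(q\to q)$; (8) $\vdash p\leftrightarrow\neg\neg p$; (9) $\vdash(\neg p\to q)\leftrightarrow(\neg q\to p)$; (10) $\vdash(\neg p)^+\leftrightarrow\neg p^-$ and $\vdash(\neg p)^-\leftrightarrow\neg p^+$; (11) $\vdash(p\vee q)\leftrightarrow(q\vee p)$.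
   Context: The logic $\mathrm{sq}Ł^*$: $F(V)$ is the set of formulas built from a set $V$ of propositional variables with $\to$, $\neg$ and the constant $1$. Abbreviations: $p^+=(p\to1)\to1$, $p^-=(p\to\neg1)\to\neg1$, $p\vee q=((p^+\to q^+)^+\to(\neg p)^-)\to((q^-\to p^-)^-\to p^-)$; an axiom written $p\leftrightarrow q$ stands for the two axioms $p\to q$ and $q\to p$. Axioms: (Q1) $(p\to q)\leftrightarrow(\neg q\to\neg p)$; (Q2) $1\leftrightarrow((1\to p)\to1)$; (Q3) $p\leftrightarrow((q\to q)\to p)$; (Q4) $(p\to q)\leftrightarrow((q^+\to p^-)\to(p^+\to q^-))$; (Q5) $\neg(p\to q)\leftrightarrow(q\to p)$; (Q6) $(p\to(\neg p\to q))^+\leftrightarrow(p^+\to(\neg p^+\to q^+))$; (Q7) $(p\to(q\vee r))\leftrightarrow((p\to r)\vee(p\to q))$; (Q8) $(p\vee(q\vee r))\leftrightarrow((p\vee q)\vee r)$; (Q9) $((p\to1)\to((q\to1)\to r))\to((q\to1)\to((p\to1)\to r))$; (Q10) $p\to1$. Rules: (qMP) $(r\to r)\to p,\ (r\to r)\to(p\to q)\vdash(r\to r)\to q$; (Reg) $p\vdash(r\to r)\to p$; (AReg1) $(r\to r)\to(p\to q)\vdash p\to q$; (AReg2) $(r\to r)\to\neg(p\to q)\vdash\neg(p\to q)$; (AReg3) $(r\to r)\to\neg1\vdash\neg1$; (AReg4) $(r\to r)\to1\vdash1$; (Inv1) $p\vdash\neg\neg p$; (Inv2) $\neg\neg p\vdash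 p$; (Flat) $p,\neg1\vdash\neg p$; (R2$'$) $p\to q,\ r\to t\vdash(q\to r)\to(p\to t)$; (R3$'$) $(r\to r)\to p\vdash p^-$. $\vdash_{\mathrm{sq}Ł^*}q$ means there is a finite sequence ending in $q$ each member of which is an axiom or obtained from earlier members by a rule. -}

module Defs where

open import Data.Maybe using (Maybe; just; nothing)
open import Data.Product using (_×_)

data Fm (V : Set) : Set where
  var  : V → Fm V
  _⇒_  : Fm V → Fm V → Fm V
  ~_   : Fm V → Fm V
  𝟏    : Fm V

infixr 5 _⇒_
infix 8 ~_

module _ {V : Set} where

  _⁺ : Fm V → Fm V
  p ⁺ = (p ⇒ 𝟏) ⇒ 𝟏

  _⁻ : Fm V → Fm V
  p ⁻ = (p ⇒ ~ 𝟏) ⇒ ~ 𝟏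

  infix 9 _⁺ _⁻

  _∨_ : Fm V → Fm V → Fm V
  p ∨ q = (((p ⁺ ⇒ q ⁺) ⁺) ⇒ (~ p) ⁻) ⇒ (((q ⁻ ⇒ p ⁻) ⁻) ⇒ p ⁻)

  infixr 4 _∨_

  -- Derivability in sqŁ*: inductive closure of the axioms under the rules
  -- (equivalent to existence of a finite derivation sequence).
  data ⊢_ : Fm V → Set where
    Q1a  : ∀ p q → ⊢ ((p ⇒ q) ⇒ (~ q ⇒ ~ p))
    Q1b  : ∀ p q → ⊢ ((~ q ⇒ ~ p) ⇒ (p ⇒ q))
    Q2a  : ∀ p → ⊢ (𝟏 ⇒ ((𝟏 ⇒ p) ⇒ 𝟏))
    Q2b  : ∀ p → ⊢ (((𝟏 ⇒ p) ⇒ 𝟏) ⇒ 𝟏)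
    Q3a  : ∀ p q → ⊢ (p ⇒ ((q ⇒ q) ⇒ p))
    Q3b  : ∀ p q → ⊢ (((q ⇒ q) ⇒ p) ⇒ p)
    Q4a  : ∀ p q → ⊢ ((p ⇒ q) ⇒ ((q ⁺ ⇒ p ⁻) ⇒ (p ⁺ ⇒ q ⁻)))
    Q4b  : ∀ p q → ⊢ (((q ⁺ ⇒ p ⁻) ⇒ (p ⁺ ⇒ q ⁻)) ⇒ (p ⇒ q))
    Q5a  : ∀ p q → ⊢ (~ (p ⇒ q) ⇒ (q ⇒ p))
    Q5b  : ∀ p q → ⊢ ((q ⇒ p) ⇒ ~ (p ⇒ q))
    Q6a  : ∀ p q → ⊢ (((p ⇒ (~ p ⇒ q)) ⁺) ⇒ (p ⁺ ⇒ (~ (p ⁺) ⇒ q ⁺)))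
    Q6b  : ∀ p q → ⊢ ((p ⁺ ⇒ (~ (p ⁺) ⇒ q ⁺)) ⇒ ((p ⇒ (~ p ⇒ q)) ⁺))
    Q7a  : ∀ p q r → ⊢ ((p ⇒ (q ∨ r)) ⇒ ((p ⇒ r) ∨ (p ⇒ q)))
    Q7b  : ∀ p q r → ⊢ (((p ⇒ r) ∨ (p ⇒ q)) ⇒ (p ⇒ (q ∨ r)))
    Q8a  : ∀ p q r → ⊢ ((p ∨ (q ∨ r)) ⇒ ((p ∨ q) ∨ r))
    Q8b  : ∀ p q r → ⊢ (((p ∨ q) ∨ r) ⇒ (p ∨ (q ∨ r)))
    Q9   : ∀ p q r → ⊢ (((p ⇒ 𝟏) ⇒ ((q ⇒ 𝟏) ⇒ r)) ⇒ ((q ⇒ 𝟏) ⇒ ((p ⇒ 𝟏) ⇒ r)))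
    Q10  : ∀ p → ⊢ (p ⇒ 𝟏)
    qMP  : ∀ {p q r} → ⊢ ((r ⇒ r) ⇒ p) → ⊢ ((r ⇒ r) ⇒ (p ⇒ q)) → ⊢ ((r ⇒ r) ⇒ q)
    Reg  : ∀ {p} r → ⊢ p → ⊢ ((r ⇒ r) ⇒ p)
    AReg1 : ∀ {p q r} → ⊢ ((r ⇒ r) ⇒ (p ⇒ q)) → ⊢ (p ⇒ q)
    AReg2 : ∀ {p q r} → ⊢ ((r ⇒ r) ⇒ ~ (p ⇒ q)) → ⊢ (~ (p ⇒ q))
    AReg3 : ∀ {r} → ⊢ ((r ⇒ r) ⇒ ~ 𝟏) → ⊢ (~ 𝟏)
    AReg4 : ∀ {r} → ⊢ ((r ⇒ r) ⇒ 𝟏) → ⊢ 𝟏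
    Inv1 : ∀ {p} → ⊢ p → ⊢ (~ ~ p)
    Inv2 : ∀ {p} → ⊢ (~ ~ p) → ⊢ p
    Flat : ∀ {p} → ⊢ p → ⊢ (~ 𝟏) → ⊢ (~ p)
    R2′  : ∀ {p q r t} → ⊢ (p ⇒ q) → ⊢ (r ⇒ t) → ⊢ ((q ⇒ r) ⇒ (p ⇒ t))
    R3′  : ∀ {p r} → ⊢ ((r ⇒ r) ⇒ p) → ⊢ (p ⁻)

  infix 2 ⊢_

  ⊢_↔_ : Fm V → Fm V → Set
  ⊢ p ↔ q = (⊢ (p ⇒ q)) × (⊢ (q ⇒ p))

  infix 2 ⊢_↔_

-- Replacement: a template C over V extended by a hole variable (nothing);
-- C [ s ] substitutes s for every hole occurrence. Thus p = C [ p₁ ] and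
-- r = C [ r₁ ] means r arises from p by replacing (some chosen occurrences
-- of) the subformula p₁ with r₁.
_[_] : {V : Set} → Fm (Maybe V) → Fm V → Fm V
var (just x)  [ s ] = var x
var nothing   [ s ] = s
(a ⇒ b)       [ s ] = (a [ s ]) ⇒ (b [ s ])
(~ a)         [ s ] = ~ (a [ s ])
𝟏             [ s ] = 𝟏

module Submission where

-- Modus ponens is available for implicational conclusions: regularize both
-- premises, combine them with qMP and strip the regularization with AReg1.
-- With R2′ and Q3 this makes ⇒ transitive and reflexive, and with R2′ and Q1
-- it makes ↔ a congruence, so every item reduces to rewriting along axioms.

open import Defs
open import Data.Maybe using (Maybe; just; nothing)
open import Data.Product using (_×_; _,_; proj₁; proj₂)

module _ {V : Set} where

  ⇒-mp : {a b c : Fm V} → ⊢ a → ⊢ (a ⇒ (b ⇒ c)) → ⊢ (b ⇒ c)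
  ⇒-mp {a} ⊢a ⊢a⇒b⇒c = AReg1 (qMP (Reg a ⊢a) (Reg a ⊢a⇒b⇒c))

  ⇒-trans : {a b c : Fm V} → ⊢ (a ⇒ b) → ⊢ (b ⇒ c) → ⊢ (a ⇒ c)
  ⇒-trans {a} {b} {c} a⇒b b⇒c = ⇒-mp (R2′ a⇒b b⇒c) (Q3b (a ⇒ c) b)

  ⇒-refl : (p : Fm V) → ⊢ (p ⇒ p)
  ⇒-refl p = ⇒-trans (Q3a p p) (Q3b p p)

  ↔-refl : (p : Fm V) → ⊢ p ↔ p
  ↔-refl p = ⇒-refl p , ⇒-refl p

  ↔-sym : {p q : Fm V} → ⊢ p ↔ q → ⊢ q ↔ p
  ↔-sym (p⇒q , q⇒p) = q⇒p , p⇒q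

  ↔-trans : {p q r : Fm V} → ⊢ p ↔ q → ⊢ q ↔ r → ⊢ p ↔ r
  ↔-trans (p⇒q , q⇒p) (q⇒r , r⇒q) = ⇒-trans p⇒q q⇒r , ⇒-trans r⇒q q⇒p

  ~-cong : {p q : Fm V} → ⊢ p ↔ q → ⊢ ~ p ↔ ~ q
  ~-cong {p} {q} (p⇒q , q⇒p) = ⇒-mp q⇒p (Q1a q p) , ⇒-mp p⇒q (Q1a p q)

  ⇒-cong : {p q r t : Fm V} → ⊢ p ↔ q → ⊢ r ↔ t → ⊢ (p ⇒ r) ↔ (q ⇒ t)
  ⇒-cong (p⇒q , q⇒p) (r⇒t , t⇒r) = R2′ q⇒p r⇒t , R2′ p⇒q t⇒r

  ⁺-cong : {p q : Fm V} → ⊢ p ↔ q → ⊢ p ⁺ ↔ q ⁺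
  ⁺-cong p↔q = ⇒-cong (⇒-cong p↔q (↔-refl 𝟏)) (↔-refl 𝟏)

  ⁻-cong : {p q : Fm V} → ⊢ p ↔ q → ⊢ p ⁻ ↔ q ⁻
  ⁻-cong p↔q = ⇒-cong (⇒-cong p↔q (↔-refl (~ 𝟏))) (↔-refl (~ 𝟏))

  ∨-cong : {p q r t : Fm V} → ⊢ p ↔ q → ⊢ r ↔ t → ⊢ (p ∨ r) ↔ (q ∨ t)
  ∨-cong p↔q r↔t =
    ⇒-cong (⇒-cong (⁺-cong (⇒-cong (⁺-cong p↔q) (⁺-cong r↔t))) (⁻-cong (~-cong p↔q)))
           (⇒-cong (⁻-cong (⇒-cong (⁻-cong r↔t) (⁻-cong p↔q))) (⁻-cong p↔q))

  []-cong : (C : Fm (Maybe V)) {p₁ r₁ : Fm V} → ⊢ p₁ ↔ r₁ → ⊢ (C [ p₁ ]) ↔ (C [ r₁ ])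
  []-cong (var (just x)) p₁↔r₁ = ↔-refl (var x)
  []-cong (var nothing)  p₁↔r₁ = p₁↔r₁
  []-cong (C ⇒ D)        p₁↔r₁ = ⇒-cong ([]-cong C p₁↔r₁) ([]-cong D p₁↔r₁)
  []-cong (~ C)          p₁↔r₁ = ~-cong ([]-cong C p₁↔r₁)
  []-cong 𝟏              p₁↔r₁ = ↔-refl 𝟏

  ~-⇒-distrib : (p q : Fm V) → ⊢ ~ (p ⇒ q) ↔ (~ p ⇒ ~ q)
  ~-⇒-distrib p q = ↔-trans (Q5a p q , Q5b p q) (Q1a q p , Q1b q p)

  ⇒-refl-↔ : (p q : Fm V) → ⊢ (p ⇒ p) ↔ (q ⇒ q)
  ⇒-refl-↔ p q = ⇒-mp (⇒-refl q) (Q3a (q ⇒ q) p) , ⇒-mp (⇒-refl p) (Q3a (p ⇒ p) q)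

  𝟏⇒𝟏⇒-elim : (p : Fm V) → ⊢ p ↔ ((𝟏 ⇒ 𝟏) ⇒ p)
  𝟏⇒𝟏⇒-elim p = Q3a p 𝟏 , Q3b p 𝟏

  ~~-intro-⇒ : (a b : Fm V) → ⊢ (a ⇒ b) ↔ ~ ~ (a ⇒ b)
  ~~-intro-⇒ a b = ↔-sym (↔-trans (~-cong (Q5a a b , Q5b a b)) (Q5a b a , Q5b b a))

  -- Q5 only handles negated implications, so p is first rewritten as (1 ⇒ 1) ⇒ p.
  ~~-intro : (p : Fm V) → ⊢ p ↔ ~ ~ p
  ~~-intro p =
    ↔-trans (𝟏⇒𝟏⇒-elim p)
      (↔-trans (~~-intro-⇒ (𝟏 ⇒ 𝟏) p) (~-cong (~-cong (↔-sym (𝟏⇒𝟏⇒-elim p)))))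

  contraposition : (p q : Fm V) → ⊢ (~ p ⇒ q) ↔ (~ q ⇒ p)
  contraposition p q =
    ↔-trans (Q1a (~ p) q , Q1b (~ p) q) (⇒-cong (↔-refl (~ q)) (↔-sym (~~-intro p)))

  ~-⁺ : (p : Fm V) → ⊢ (~ p) ⁺ ↔ ~ (p ⁻)
  ~-⁺ p = ↔-sym (↔-trans (~-⇒-distrib (p ⇒ ~ 𝟏) (~ 𝟏))
            (⇒-cong (↔-trans (~-⇒-distrib p (~ 𝟏)) (⇒-cong (↔-refl (~ p)) ~~𝟏↔𝟏))
                    ~~𝟏↔𝟏))
    where
    ~~𝟏↔𝟏 : ⊢ ~ ~ 𝟏 ↔ 𝟏
    ~~𝟏↔𝟏 = ↔-sym (~~-intro 𝟏)

  ~-⁻ : (p : Fm V) → ⊢ (~ p) ⁻ ↔ ~ (p ⁺)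
  ~-⁻ p = ↔-sym (↔-trans (~-⇒-distrib (p ⇒ 𝟏) 𝟏)
            (⇒-cong (~-⇒-distrib p 𝟏) (↔-refl (~ 𝟏))))

  -- Q7 at 1 ⇒ 1 swaps the disjuncts; Q3 removes the prefix (1 ⇒ 1) ⇒ _ on both sides.
  ∨-comm-⇒ : (p q : Fm V) → ⊢ ((p ∨ q) ⇒ (q ∨ p))
  ∨-comm-⇒ p q =
    ⇒-trans (proj₁ (𝟏⇒𝟏⇒-elim (p ∨ q)))
      (⇒-trans (Q7a (𝟏 ⇒ 𝟏) p q) (proj₂ (∨-cong (𝟏⇒𝟏⇒-elim q) (𝟏⇒𝟏⇒-elim p))))

  ∨-comm : (p q : Fm V) → ⊢ (p ∨ q) ↔ (q ∨ p)
  ∨-comm p q = ∨-comm-⇒ p q , ∨-comm-⇒ q p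

proposition4p1 : {V : Set} →
    (∀ (p q : Fm V) → ⊢ p ↔ q → ⊢ ~ p ↔ ~ q)
    × (∀ (p q r t : Fm V) → ⊢ p ↔ q → ⊢ r ↔ t → ⊢ (p ⇒ r) ↔ (q ⇒ t))
    × (∀ (p q r : Fm V) → ⊢ p ↔ q → ⊢ q ↔ r → ⊢ p ↔ r)
    × (∀ (p q : Fm V) → ⊢ ~ (p ⇒ q) ↔ (~ p ⇒ ~ q))
    × (∀ (p : Fm V) → ⊢ (p ⇒ p))
    × (∀ (C : Fm (Maybe V)) (p₁ r₁ : Fm V) → ⊢ p₁ ↔ r₁ → ⊢ (C [ p₁ ]) ↔ (C [ r₁ ]))
    × (∀ (p q : Fm V) → ⊢ (p ⇒ p) ↔ (q ⇒ q))
    × (∀ (p : Fm V) → ⊢ p ↔ ~ ~ p)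
    × (∀ (p q : Fm V) → ⊢ (~ p ⇒ q) ↔ (~ q ⇒ p))
    × (∀ (p : Fm V) → (⊢ (~ p) ⁺ ↔ ~ (p ⁻)) × (⊢ (~ p) ⁻ ↔ ~ (p ⁺)))
    × (∀ (p q : Fm V) → ⊢ (p ∨ q) ↔ (q ∨ p))
proposition4p1 =
    (λ _ _ → ~-cong)
  , (λ _ _ _ _ → ⇒-cong)
  , (λ _ _ _ → ↔-trans)
  , ~-⇒-distrib
  , ⇒-refl
  , (λ C _ _ → []-cong C)
  , ⇒-refl-↔
  , ~~-intro
  , contraposition
  , (λ p → ~-⁺ p , ~-⁻ p)
  , ∨-comm
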